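{- If $k\ge 1$ is odd and $l\ge 0$ is an integer, then $v_{lk+(k+3)/2}\equiv 0\pmod{(2l+1)^2k^{2l+2}}$.
   Context: For an integer $n\ge 1$ let $v_n=\Big[(1-x)\prod_{j=0}^{2n-3}(2n-3-j+jx)\Big]_{x^{n-1}}$, where $[f(x)]_{x^m}$ denotes the coefficient of $x^m$ in $f$. -}

module Defs where

open import Data.Nat as ℕ using (ℕ; zero; suc; _∸_)
open import Data.Integer using (ℤ; +_; _+_; _*_; -_; 0ℤ; 1ℤ)
open import Data.List using (List; []; _∷_; upTo; foldr; map)

-- Polynomials over ℤ as coefficient lists, lowest degree first.
Poly : Set
Poly = List ℤ

_⊕_ : Poly → Poly → Poly
[]       ⊕ q        = q
p        ⊕ []       = p
(a ∷ p)  ⊕ (b ∷ q)  = (a + b) ∷ (p ⊕ q)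

scale : ℤ → Poly → Poly
scale c = map (c *_)

_⊗_ : Poly → Poly → Poly
[]      ⊗ q = []
(a ∷ p) ⊗ q = scale a q ⊕ (0ℤ ∷ (p ⊗ q))

coeff : Poly → ℕ → ℤ
coeff []      _       = 0ℤ
coeff (a ∷ p) zero    = a
coeff (a ∷ p) (suc m) = coeff p m

-- v n = [ (1 - x) * ∏_{j=0}^{2n-3} ((2n-3-j) + j x) ]_{x^{n-1}}
-- the product has 2n-2 factors (j ranges over upTo (2n-2)); empty for n = 1.
v : ℕ → ℤ
v n = coeff ((1ℤ ∷ - 1ℤ ∷ []) ⊗ foldr (λ j acc → ((+ (N ∸ j)) ∷ (+ j) ∷ []) ⊗ acc) (1ℤ ∷ []) (upTo (2 ℕ.* n ∸ 2))) (n ∸ 1)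
  where
  N : ℕ
  N = 2 ℕ.* n ∸ 3

-- Each factor (N - j) + j x of the product has all its coefficients divisible by
-- gcd (N - j, j), so every coefficient of (1 - x) times the product, v n among them,
-- is divisible by the product of these gcds over 0 ≤ j ≤ N, where N = 2n - 3.
-- For n = lk + (k + 3)/2 we have N = (2l + 1) k: the terms j = 0 and j = N each
-- contribute a factor N, and the 2l multiples j = k, 2k, …, 2lk of k in between
-- each contribute a factor k, giving N² k^(2l) = (2l + 1)² k^(2l + 2).
module Submission where

open import Defs
open import Data.Nat using (ℕ; _+_; _*_; _^_; _/_)
open import Data.Integer using (+_)
open import Data.Integer.Divisibility using (_∣_)

open import Data.Nat using (zero; suc; _∸_; NonZero)
open import Data.Nat.Properties
  using (+-identityʳ; *-identityʳ; *-assoc; *-distribʳ-∸; n∸n≡0; +-comm; ^-distribˡ-+-*)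
open import Data.Nat.Divisibility as ℕ
  using (divides; divides-refl; ∣-refl; ∣-reflexive; ∣-trans; *-pres-∣; n∣m*n; m∣m*n)
open import Data.Nat.DivMod using (m*n/n≡m)
open import Data.Nat.GCD using (gcd; gcd[m,n]∣m; gcd[m,n]∣n; gcd-greatest; gcd-identityˡ; gcd-identityʳ)
open import Data.Nat.ListAction using (product)
open import Data.Nat.ListAction.Properties using (product-++)
open import Data.Nat.Tactic.RingSolver using (solve-∀)
open import Data.Nat.Solver using (module +-*-Solver)
open +-*-Solver using (solve; _:+_; _:*_; _:^_; _:=_; con)
open import Data.Integer as ℤ using (ℤ; 0ℤ; 1ℤ; -_)
open import Data.Integer.Properties using (pos-*; *-identityˡ)
import Data.Integer.Divisibility.Signed as Signed
open import Data.List using (List; []; _∷_; [_]; _∷ʳ_; foldr; map; upTo; applyUpTo)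
open import Data.List.Properties using (applyUpTo-∷ʳ; map-upTo)
open import Data.List.Relation.Unary.All as All using (All; []; _∷_)
open import Data.List.Relation.Unary.All.Properties using (map⁺)
open import Function using (_∘_)
open import Relation.Binary.PropositionalEquality using (_≡_; refl; sym; trans; cong; subst; subst₂; module ≡-Reasoning)

infix 4 _∣ₚ_

_∣ₚ_ : ℤ → Poly → Set
d ∣ₚ p = All (d Signed.∣_) p

*-pres-∣ˢ : ∀ {d e a b} → d Signed.∣ a → e Signed.∣ b → d ℤ.* e Signed.∣ a ℤ.* b
*-pres-∣ˢ {e = e} {a = a} d∣a e∣b = Signed.∣-trans (Signed.*-monoˡ-∣ e d∣a) (Signed.*-monoʳ-∣ a e∣b)

∣ˢ0 : ∀ d → d Signed.∣ 0ℤ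
∣ˢ0 d = Signed.divides 0ℤ refl

1∣ₚ : ∀ p → 1ℤ ∣ₚ p
1∣ₚ = All.universal (λ a → Signed.∣ᵤ⇒∣ (ℕ.1∣ _))

∣ₚ-⊕ : ∀ {d p q} → d ∣ₚ p → d ∣ₚ q → d ∣ₚ p ⊕ q
∣ₚ-⊕ []            d∣q           = d∣q
∣ₚ-⊕ (d∣a ∷ d∣p)   []            = d∣a ∷ d∣p
∣ₚ-⊕ (d∣a ∷ d∣p)   (d∣b ∷ d∣q)   = Signed.∣m∣n⇒∣m+n d∣a d∣b ∷ ∣ₚ-⊕ d∣p d∣q

∣ₚ-scale : ∀ {d e a q} → d Signed.∣ a → e ∣ₚ q → d ℤ.* e ∣ₚ scale a q
∣ₚ-scale d∣a e∣q = map⁺ (All.map (*-pres-∣ˢ d∣a) e∣q)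

∣ₚ-⊗ : ∀ {d e p q} → d ∣ₚ p → e ∣ₚ q → d ℤ.* e ∣ₚ p ⊗ q
∣ₚ-⊗ []            e∣q = []
∣ₚ-⊗ (d∣a ∷ d∣p)   e∣q = ∣ₚ-⊕ (∣ₚ-scale d∣a e∣q) (∣ˢ0 _ ∷ ∣ₚ-⊗ d∣p e∣q)

∣ₚ-coeff : ∀ {d p} → d ∣ₚ p → ∀ i → d Signed.∣ coeff p i
∣ₚ-coeff []            i       = ∣ˢ0 _
∣ₚ-coeff (d∣a ∷ _)     zero    = d∣a
∣ₚ-coeff (_ ∷ d∣p)     (suc i) = ∣ₚ-coeff d∣p i

linearFactor : ℕ → ℕ → Poly
linearFactor N j = + (N ∸ j) ∷ + j ∷ []

linearProduct : ℕ → List ℕ → Poly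
linearProduct N = foldr (λ j acc → linearFactor N j ⊗ acc) (1ℤ ∷ [])

content : ℕ → ℕ → ℕ
content N j = gcd (N ∸ j) j

content-∣ₚ-linearFactor : ∀ N j → + content N j ∣ₚ linearFactor N j
content-∣ₚ-linearFactor N j =
  Signed.∣ᵤ⇒∣ (gcd[m,n]∣m (N ∸ j) j) ∷ Signed.∣ᵤ⇒∣ (gcd[m,n]∣n (N ∸ j) j) ∷ []

∣ₚ-linearProduct : ∀ N xs → + product (map (content N) xs) ∣ₚ linearProduct N xs
∣ₚ-linearProduct N []       = Signed.∣-refl ∷ []
∣ₚ-linearProduct N (j ∷ xs) = subst (_∣ₚ linearProduct N (j ∷ xs)) (sym (pos-* (content N j) _))
  (∣ₚ-⊗ (content-∣ₚ-linearFactor N j) (∣ₚ-linearProduct N xs))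

v-divisible : ∀ n → + product (applyUpTo (content (2 * n ∸ 3)) (2 * n ∸ 2)) ∣ v n
v-divisible n = Signed.∣⇒∣ᵤ (∣ₚ-coeff (subst (_∣ₚ 1-x ⊗ P) (*-identityˡ d) (∣ₚ-⊗ (1∣ₚ 1-x) d∣ₚP)) (n ∸ 1))
  where
  1-x : Poly
  1-x = 1ℤ ∷ - 1ℤ ∷ []
  N : ℕ
  N = 2 * n ∸ 3
  d : ℤ
  d = + product (applyUpTo (content N) (2 * n ∸ 2))
  P : Poly
  P = linearProduct N (upTo (2 * n ∸ 2))
  d∣ₚP : d ∣ₚ P
  d∣ₚP = subst (λ xs → + product xs ∣ₚ P) (map-upTo (content N) (2 * n ∸ 2)) (∣ₚ-linearProduct N (upTo (2 * n ∸ 2)))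

content-zero : ∀ N → content N 0 ≡ N
content-zero = gcd-identityʳ

content-self : ∀ N → content N N ≡ N
content-self N = trans (cong (λ a → gcd a N) (n∸n≡0 N)) (gcd-identityˡ N)

∣-content : ∀ {k N j} → k ℕ.∣ N → k ℕ.∣ j → k ℕ.∣ content N j
∣-content {k} (divides-refl q) (divides-refl r) = gcd-greatest (divides (q ∸ r) (sym (*-distribʳ-∸ k q r))) (n∣m*n r)

product-applyUpTo-+ : ∀ (f : ℕ → ℕ) m n →
  product (applyUpTo f (m + n)) ≡ product (applyUpTo f m) * product (applyUpTo (f ∘ (_+_ m)) n)
product-applyUpTo-+ f zero    n = sym (+-identityʳ _)
product-applyUpTo-+ f (suc m) n = begin
  f 0 * product (applyUpTo (f ∘ suc) (m + n))
    ≡⟨ cong (f 0 *_) (product-applyUpTo-+ (f ∘ suc) m n) ⟩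
  f 0 * (product (applyUpTo (f ∘ suc) m) * product (applyUpTo (f ∘ (_+_ (suc m))) n))
    ≡⟨ sym (*-assoc (f 0) _ _) ⟩
  f 0 * product (applyUpTo (f ∘ suc) m) * product (applyUpTo (f ∘ (_+_ (suc m))) n) ∎
  where open ≡-Reasoning

product-applyUpTo-suc : ∀ (f : ℕ → ℕ) n → product (applyUpTo f (suc n)) ≡ product (applyUpTo f n) * f n
product-applyUpTo-suc f n = begin
  product (applyUpTo f (suc n))            ≡⟨ cong product (sym (applyUpTo-∷ʳ f n)) ⟩
  product (applyUpTo f n ∷ʳ f n)           ≡⟨ product-++ (applyUpTo f n) [ f n ] ⟩
  product (applyUpTo f n) * (f n * 1)      ≡⟨ cong (product (applyUpTo f n) *_) (*-identityʳ (f n)) ⟩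
  product (applyUpTo f n) * f n            ∎
  where open ≡-Reasoning

∣-product-applyUpTo-head : ∀ (f : ℕ → ℕ) n .{{_ : NonZero n}} → f 0 ℕ.∣ product (applyUpTo f n)
∣-product-applyUpTo-head f (suc n) = m∣m*n _

^-∣-product-applyUpTo-blocks : ∀ (f : ℕ → ℕ) k .{{_ : NonZero k}} → (∀ b → k ℕ.∣ f (b * k)) →
  ∀ q → k ^ q ℕ.∣ product (applyUpTo f (q * k))
^-∣-product-applyUpTo-blocks f k k∣f zero    = ∣-refl
^-∣-product-applyUpTo-blocks f k k∣f (suc q) =
  subst (k ^ suc q ℕ.∣_) (sym (product-applyUpTo-+ f k (q * k)))
    (*-pres-∣ (∣-trans (k∣f 0) (∣-product-applyUpTo-head f k))
              (^-∣-product-applyUpTo-blocks (f ∘ (_+_ k)) k (k∣f ∘ suc) q))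

contentProduct-divisible : ∀ t k .{{_ : NonZero k}} → let M = suc t * k in
  M * k ^ t * M ℕ.∣ product (applyUpTo (content M) (suc M))
contentProduct-divisible t k = subst (M * k ^ t * M ℕ.∣_) (sym splitting)
  (*-pres-∣ (*-pres-∣ first middle) (∣-reflexive (sym (content-self M))))
  where
  M : ℕ
  M = suc t * k
  splitting : product (applyUpTo (content M) (suc M)) ≡
    product (applyUpTo (content M) k) * product (applyUpTo (content M ∘ (_+_ k)) (t * k)) * content M M
  splitting = begin
    product (applyUpTo (content M) (suc M))  ≡⟨ product-applyUpTo-suc (content M) M ⟩
    product (applyUpTo (content M) M) * content M M
      ≡⟨ cong (_* content M M) (product-applyUpTo-+ (content M) k (t * k)) ⟩
    product (applyUpTo (content M) k) * product (applyUpTo (content M ∘ (_+_ k)) (t * k)) * content M M ∎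
    where open ≡-Reasoning
  first : M ℕ.∣ product (applyUpTo (content M) k)
  first = ∣-trans (∣-reflexive (sym (content-zero M))) (∣-product-applyUpTo-head (content M) k)
  middle : k ^ t ℕ.∣ product (applyUpTo (content M ∘ (_+_ k)) (t * k))
  middle = ^-∣-product-applyUpTo-blocks (content M ∘ (_+_ k)) k
    (λ b → ∣-content (n∣m*n (suc t)) (n∣m*n (suc b))) t

twice-index : ∀ m l → 2 * (l * (2 * m + 1) + ((2 * m + 1) + 3) / 2) ≡ 3 + suc (2 * l) * suc (2 * m)
twice-index m l = trans (cong (λ h → 2 * (l * (2 * m + 1) + h)) half) (expand m l)
  where
  doubled : ∀ a → (2 * a + 1) + 3 ≡ (a + 2) * 2
  doubled = solve-∀
  half : ((2 * m + 1) + 3) / 2 ≡ m + 2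
  half = trans (cong (_/ 2) (doubled m)) (m*n/n≡m (m + 2) 2)
  expand : ∀ a b → 2 * (b * (2 * a + 1) + (a + 2)) ≡ 3 + (1 + 2 * b) * (1 + 2 * a)
  expand = solve-∀

modulus-factorisation : ∀ m l → let k = suc (2 * m); M = suc (2 * l) * k in
  (2 * l + 1) ^ 2 * (2 * m + 1) ^ (2 * l + 2) ≡ M * k ^ (2 * l) * M
modulus-factorisation m l = begin
  (2 * l + 1) ^ 2 * (2 * m + 1) ^ (2 * l + 2)
    ≡⟨ cong ((2 * l + 1) ^ 2 *_) (^-distribˡ-+-* (2 * m + 1) (2 * l) 2) ⟩
  (2 * l + 1) ^ 2 * ((2 * m + 1) ^ (2 * l) * (2 * m + 1) ^ 2)
    ≡⟨ cong (λ a → (2 * l + 1) ^ 2 * (a ^ (2 * l) * a ^ 2)) (+-comm (2 * m) 1) ⟩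
  (2 * l + 1) ^ 2 * (suc (2 * m) ^ (2 * l) * suc (2 * m) ^ 2)
    ≡⟨ regroup (2 * m) (2 * l) (suc (2 * m) ^ (2 * l)) ⟩
  suc (2 * l) * suc (2 * m) * suc (2 * m) ^ (2 * l) * (suc (2 * l) * suc (2 * m)) ∎
  where
  open ≡-Reasoning
  regroup : ∀ a b p → (b + 1) ^ 2 * (p * (1 + a) ^ 2) ≡ (1 + b) * (1 + a) * p * ((1 + b) * (1 + a))
  regroup = solve 3 (λ a b p → (b :+ con 1) :^ 2 :* (p :* (con 1 :+ a) :^ 2)
                             := (con 1 :+ b) :* (con 1 :+ a) :* p :* ((con 1 :+ b) :* (con 1 :+ a))) refl

mainTheorem8 : (m l : ℕ) →
    + ((2 * l + 1) ^ 2 * (2 * m + 1) ^ (2 * l + 2)) ∣ v (l * (2 * m + 1) + ((2 * m + 1) + 3) / 2)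
mainTheorem8 m l = ∣-trans modulus∣contentProduct (v-divisible n)
  where
  n : ℕ
  n = l * (2 * m + 1) + ((2 * m + 1) + 3) / 2
  modulus∣contentProduct :
    (2 * l + 1) ^ 2 * (2 * m + 1) ^ (2 * l + 2) ℕ.∣ product (applyUpTo (content (2 * n ∸ 3)) (2 * n ∸ 2))
  modulus∣contentProduct =
    subst₂ ℕ._∣_ (sym (modulus-factorisation m l))
                 (cong (λ a → product (applyUpTo (content (a ∸ 3)) (a ∸ 2))) (sym (twice-index m l)))
                 (contentProduct-divisible (2 * l) (suc (2 * m)))
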